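{- Let $K$ be a $d$-dimensional simplicial complex and $(F,R)$ a rooted forest of $K$ that corresponds to a discrete gradient vector field. Then $H_{d-1}(F,R)\cong 0$.
   Context: A simplicial complex $K$ is a finite family of finite sets closed under subsets; $K_p$ is the set of $p$-cells (elements of size $p+1$), $K_{\le p}$ the $p$-skeleton. The incidence matrix $\partial_d$ has rows indexed by $K_{d-1}$, columns by $K_d$, entry $(-1)^j$ at $(r,f)$ if $f=\{v_0<\dots<v_d\}$, $r=f\setminus\{v_j\}$, and $0$ otherwise. For $F\subseteq K_d$, $R\subseteq K_{d-1}$, $\bar R=K_{d-1}\setminus R$, $(F,R)$ is a rooted forest of $K$ if the columns of $\partial_d$ indexed by $F$ are independent and the rows indexed by $\bar R$ of the submatrix with columns $F$ form a basis of its row space. $H_{d-1}(F,R)$ denotes the $(d-1)$-st integral simplicial homology of the pair $(K_{\le d-1}\cup F,\ K_{\le d-2}\cup R)$. A discrete Morse function is $f:K\to\mathbb{R}$ such that each $p$-cell $\sigma$ has at most one $(p-1)$-face $\tau$ with $f(\tau)\ge f(\sigma)$ and at most one $(p+1)$-coface $\tau$ with $f(\tau)\le f(\sigma)$; $\sigma$ is critical if there are none; $c_p(f)$ counts critical $p$-cells. $\mathcal{M}(K)$ is the set of discrete Morse functions modulo equality of gradients $V_f=\{(\sigma,\tau):\sigma\text{ a codim-one face of }\tau,\ f(\tau)\le f(\sigma)\}$; $\mathcal{M}_\ell(K)=\{f: c_d(f)=\ell,\ c_p(f)=|K_p|\ \forall p<d-1\}$. $(F,R)$ corresponds to a gradient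 if for some $\ell$ there is $f\in\mathcal{M}_\ell(K)$ whose non-critical $d$-cells are exactly $F$ and whose critical $(d-1)$-cells are exactly $R$.
   Formalization: The discrete Morse function witnessing that (F,R) corresponds to a discrete gradient vector field takes values only in ℚ instead of ℝ. -}

module Defs where

open import Data.Bool using (Bool; true; false; _∧_; _∨_; not; T; if_then_else_)
open import Data.Nat using (ℕ; zero; suc; _≡ᵇ_; _<ᵇ_; _<_)
open import Data.Fin using (Fin; toℕ)
open import Data.Vec using (Vec; []; _∷_; tabulate)
open import Data.Fin.Subset using (Subset; ∣_∣; _∩_)
open import Data.List using (List; []; _∷_; _++_; map; filterᵇ; length; foldr)
open import Data.Bool.ListAction using (any)
open import Data.Integer as ℤ using (ℤ; +_; -_)
open import Data.Rational as ℚ using (ℚ; 0ℚ; _/_)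
open import Data.Product using (Σ; ∃; _×_)
open import Relation.Binary.PropositionalEquality using (_≡_)

-- Vertices are Fin n (with its natural total order); a finite set of
-- vertices is a Subset n.  A family of finite sets is a Bool-valued
-- predicate on Subset n (hence automatically finite).

Family : ℕ → Set
Family n = Subset n → Bool

allSubsets : (n : ℕ) → List (Subset n)
allSubsets zero    = [] ∷ []
allSubsets (suc n) = map (false ∷_) (allSubsets n) ++ map (true ∷_) (allSubsets n)

members : {n : ℕ} → Family n → List (Subset n)
members {n} 𝓐 = filterᵇ 𝓐 (allSubsets n)

_⊆ᵇ_ : {n : ℕ} → Subset n → Subset n → Bool
[]          ⊆ᵇ []          = true
(false ∷ p) ⊆ᵇ (_ ∷ q)     = p ⊆ᵇ q
(true ∷ p)  ⊆ᵇ (true ∷ q)  = p ⊆ᵇ q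
(true ∷ p)  ⊆ᵇ (false ∷ q) = false

_==_ : {n : ℕ} → Subset n → Subset n → Bool
p == q = (p ⊆ᵇ q) ∧ (q ⊆ᵇ p)

single : {n : ℕ} → Fin n → Subset n
single v = tabulate (λ u → toℕ u ≡ᵇ toℕ v)

below : {n : ℕ} → Fin n → Subset n
below v = tabulate (λ u → toℕ u <ᵇ toℕ v)

_∪ᵇ_ : {n : ℕ} → Subset n → Subset n → Subset n
[] ∪ᵇ [] = []
(x ∷ p) ∪ᵇ (y ∷ q) = (x ∨ y) ∷ (p ∪ᵇ q)

memᵇ : {n : ℕ} → Fin n → Subset n → Bool
memᵇ v p = single v ⊆ᵇ p

-- Simplicial complexes.  A p-cell is an element of size p+1 (p ≥ 0);
-- we index cells by their SIZE s = p+1.  The empty set is never a cell.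

IsSimplicialComplex : {n : ℕ} → Family n → Set
IsSimplicialComplex {n} K = (σ τ : Subset n) → T (K σ) → T (τ ⊆ᵇ σ) → T (K τ)

isCell : {n : ℕ} → Family n → Subset n → Bool
isCell K σ = K σ ∧ not (∣ σ ∣ ≡ᵇ 0)

cellOfSize : {n : ℕ} → Family n → ℕ → Subset n → Bool
cellOfSize K s σ = isCell K σ ∧ (∣ σ ∣ ≡ᵇ s)

IsDimension : {n : ℕ} → Family n → ℕ → Set
IsDimension {n} K d =
  (∃ λ σ → T (cellOfSize K (suc d) σ)) ×
  ((σ : Subset n) → T (isCell K σ) → T (∣ σ ∣ <ᵇ suc (suc d)))

-- Incidence numbers.  For f = {v_0 < … < v_k} and r = f ∖ {v_j} the
-- entry is (-1)^j (j = number of elements of r below v_j); else 0.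

negOnePow : ℕ → ℤ
negOnePow zero          = + 1
negOnePow (suc zero)    = - (+ 1)
negOnePow (suc (suc k)) = negOnePow k

sumℤ : {A : Set} → List A → (A → ℤ) → ℤ
sumℤ xs g = foldr (λ x acc → g x ℤ.+ acc) (+ 0) xs

sumℚ : {A : Set} → List A → (A → ℚ) → ℚ
sumℚ xs g = foldr (λ x acc → g x ℚ.+ acc) 0ℚ xs

allFinL : (n : ℕ) → List (Fin n)
allFinL n = Data.List.tabulate {n = n} (λ i → i)
  where import Data.List

incidence : {n : ℕ} → Subset n → Subset n → ℤ
incidence {n} r f =
  sumℤ (allFinL n) (λ v →
    if not (memᵇ v r) ∧ (f == (r ∪ᵇ single v))
    then negOnePow ∣ r ∩ below v ∣
    else + 0)

ℤtoℚ : ℤ → ℚ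
ℤtoℚ z = z / 1

-- Rooted forests.  Columns of ∂_d are indexed by K_d (size d+1), rows by
-- K_{d-1} (size d).  Linear algebra is over ℚ.

Rbar : {n : ℕ} → Family n → ℕ → Family n → Family n
Rbar K d R σ = cellOfSize K d σ ∧ not (R σ)

record IsRootedForest {n : ℕ} (K : Family n) (d : ℕ) (F R : Family n) : Set where
  field
    F⊆Kd   : (σ : Subset n) → T (F σ) → T (cellOfSize K (suc d) σ)
    R⊆Kd-1 : (σ : Subset n) → T (R σ) → T (cellOfSize K d σ)
    columnsIndependent : (c : Subset n → ℚ) →
      ((r : Subset n) → T (cellOfSize K d r) →
        sumℚ (members F) (λ f → ℤtoℚ (incidence r f) ℚ.* c f) ≡ 0ℚ) →
      (f : Subset n) → T (F f) → c f ≡ 0ℚ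
    rowsIndependent : (a : Subset n → ℚ) →
      ((f : Subset n) → T (F f) →
        sumℚ (members (Rbar K d R)) (λ r → a r ℚ.* ℤtoℚ (incidence r f)) ≡ 0ℚ) →
      (r : Subset n) → T (Rbar K d R r) → a r ≡ 0ℚ
    rowsSpan : (r : Subset n) → T (cellOfSize K d r) →
      Σ (Subset n → ℚ) λ a → (f : Subset n) → T (F f) →
        sumℚ (members (Rbar K d R)) (λ r′ → a r′ ℚ.* ℤtoℚ (incidence r′ f))
          ≡ ℤtoℚ (incidence r f)

faceᵇ : {n : ℕ} → Family n → Subset n → Subset n → Bool
faceᵇ K τ σ = isCell K τ ∧ isCell K σ ∧ (τ ⊆ᵇ σ) ∧ (∣ σ ∣ ≡ᵇ suc ∣ τ ∣)

IsDiscreteMorse : {n : ℕ} → Family n → (Subset n → ℚ) → Set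
IsDiscreteMorse {n} K f = (σ : Subset n) → T (isCell K σ) →
  ((τ₁ τ₂ : Subset n) → T (faceᵇ K τ₁ σ) → T (faceᵇ K τ₂ σ) →
     T (f σ ℚ.≤ᵇ f τ₁) → T (f σ ℚ.≤ᵇ f τ₂) → τ₁ ≡ τ₂) ×
  ((τ₁ τ₂ : Subset n) → T (faceᵇ K σ τ₁) → T (faceᵇ K σ τ₂) →
     T (f τ₁ ℚ.≤ᵇ f σ) → T (f τ₂ ℚ.≤ᵇ f σ) → τ₁ ≡ τ₂)

critical : {n : ℕ} → Family n → (Subset n → ℚ) → Subset n → Bool
critical {n} K f σ =
  not (any (λ τ → faceᵇ K τ σ ∧ (f σ ℚ.≤ᵇ f τ)) (allSubsets n)) ∧
  not (any (λ τ → faceᵇ K σ τ ∧ (f τ ℚ.≤ᵇ f σ)) (allSubsets n))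

numCritical : {n : ℕ} → Family n → (Subset n → ℚ) → ℕ → ℕ
numCritical K f s = length (members (λ σ → cellOfSize K s σ ∧ critical K f σ))

numCells : {n : ℕ} → Family n → ℕ → ℕ
numCells K s = length (members (cellOfSize K s))

-- f ∈ 𝓜_ℓ(K) for d = dim K:  c_d(f) = ℓ and c_p(f) = |K_p| for p < d-1
-- (p < d-1  ⇔  size p+1 < d)
InMℓ : {n : ℕ} → Family n → ℕ → ℕ → (Subset n → ℚ) → Set
InMℓ K d ℓ f =
  IsDiscreteMorse K f ×
  numCritical K f (suc d) ≡ ℓ ×
  ((s : ℕ) → s < d → numCritical K f s ≡ numCells K s)

CorrespondsToGradient : {n : ℕ} → Family n → ℕ → Family n → Family n → Set
CorrespondsToGradient {n} K d F R =
  ∃ λ ℓ → Σ (Subset n → ℚ) λ f → InMℓ K d ℓ f ×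
    ((σ : Subset n) → F σ ≡ (cellOfSize K (suc d) σ ∧ not (critical K f σ))) ×
    ((σ : Subset n) → R σ ≡ (cellOfSize K d σ ∧ critical K f σ))

-- Relative integral homology of a pair (X, A) of families, in the degree
-- whose cells have size s.  Relative s-chains: ℤ-valued functions on the
-- cells of size s of X not in A.

relCell : {n : ℕ} → Family n → Family n → ℕ → Subset n → Bool
relCell X A s σ = X σ ∧ not (A σ) ∧ not (∣ σ ∣ ≡ᵇ 0) ∧ (∣ σ ∣ ≡ᵇ s)

relBoundary : {n : ℕ} → Family n → Family n → ℕ → (Subset n → ℤ) → Subset n → ℤ
relBoundary X A s c τ = sumℤ (members (relCell X A (suc s))) (λ σ → incidence τ σ ℤ.* c σ)

IsRelCycle : {n : ℕ} → Family n → Family n → ℕ → (Subset n → ℤ) → Set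
IsRelCycle X A zero    z = Data.Unit.⊤ where import Data.Unit
IsRelCycle {n} X A (suc s) z =
  (τ : Subset n) → T (relCell X A s τ) → relBoundary X A s z τ ≡ + 0

IsRelBoundary : {n : ℕ} → Family n → Family n → ℕ → (Subset n → ℤ) → Set
IsRelBoundary {n} X A s z = Σ (Subset n → ℤ) λ b →
  (σ : Subset n) → T (relCell X A s σ) → relBoundary X A s b σ ≡ z σ

RelHomologyVanishes : {n : ℕ} → Family n → Family n → ℕ → Set
RelHomologyVanishes X A s = ∀ z → IsRelCycle X A s z → IsRelBoundary X A s z

-- the pair (K_{≤d-1} ∪ F , K_{≤d-2} ∪ R)
pairTop : {n : ℕ} → Family n → ℕ → Family n → Family n
pairTop K d F σ = (isCell K σ ∧ (∣ σ ∣ <ᵇ suc d)) ∨ F σ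

pairBot : {n : ℕ} → Family n → ℕ → Family n → Family n
pairBot K d R σ = (isCell K σ ∧ (∣ σ ∣ <ᵇ d)) ∨ R σ

-- H_{d-1}(F,R) ≅ 0   ((d-1)-cells have size d)
HdMinus1Vanishes : {n : ℕ} → Family n → ℕ → Family n → Family n → Set
HdMinus1Vanishes K d F R = RelHomologyVanishes (pairTop K d F) (pairBot K d R) d

-- The relative (d-1)-chains of the pair live on the non-critical (d-1)-cells. Since every
-- (d-2)-cell is critical, each non-critical (d-1)-cell ρ is paired by the gradient with a
-- d-cell σ, which is then non-critical and so lies in F. Its boundary coefficient at (ρ, σ)
-- is ±1, and every other d-cell σ′ having ρ as a face satisfies f σ′ > f ρ ≥ f σ by the Morse
-- condition at ρ. Ordering the columns by f therefore makes the relative boundary map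
-- unitriangular on these pairs, so every relative (d-1)-chain, cycle or not, is a boundary.

module Submission where

open import Defs
import Data.Integer.Properties as ℤP
open import Algebra.Properties.CommutativeSemigroup ℤP.+-commutativeSemigroup using (interchange)
open import Algebra.Properties.AbelianGroup ℤP.+-0-abelianGroup using (//-rightDividesˡ)
open import Data.Bool using (Bool; true; false; _∧_; not; T; if_then_else_) renaming (_≟_ to _≟ᵇ_)
open import Data.Bool.Properties using (∧-zeroʳ; ∨-identityʳ; T-∧; T-∨)
open import Data.Bool.ListAction using (any)
open import Data.Empty using (⊥-elim)
open import Data.Fin as Fin using (Fin; zero; suc)
open import Data.Fin.Subset using (Subset; ∣_∣; _∩_)
open import Data.Integer as ℤ using (ℤ; +_; -_)
open import Data.List as List using (List; []; _∷_; _++_; map; filterᵇ; length)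
open import Data.List.Membership.Propositional using (_∈_; lose)
open import Data.List.Membership.Propositional.Properties using (∈-map⁺; ∈-++⁺ˡ; ∈-++⁺ʳ)
open import Data.List.Properties using (length-filter)
open import Data.List.Relation.Unary.Any using (here; there; satisfied)
open import Data.List.Relation.Unary.Any.Properties using (any⁺; any⁻)
open import Data.Nat using (ℕ; zero; suc; _≤_; _<_; z≤n; s≤s; _≡ᵇ_; _<ᵇ_)
import Data.Nat.Properties as ℕP
open import Data.Product using (∃; _×_; _,_; proj₁; proj₂)
open import Data.Rational as ℚ using (ℚ)
import Data.Rational.Properties as ℚP
open import Data.Sum using (_⊎_; inj₁; inj₂)
open import Data.Unit using (tt)
open import Data.Vec using ([]; _∷_; tabulate)
import Data.Vec.Properties as VecP
open import Function using (_∘_; Equivalence)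
open import Relation.Nullary using (¬_; Dec; does; yes; no)
open import Relation.Nullary.Decidable using (T?; ⌊_⌋; toWitness; fromWitness)
open import Relation.Binary.PropositionalEquality

∧-intro : {a b : Bool} → T a → T b → T (a ∧ b)
∧-intro ta tb = Equivalence.from T-∧ (ta , tb)

∧-elim : {a b : Bool} → T (a ∧ b) → T a × T b
∧-elim {a} = Equivalence.to (T-∧ {a})

if-T : {A : Set} {c : Bool} {x y : A} → T c → (if c then x else y) ≡ x
if-T {c = true} _ = refl

not-intro : {b : Bool} → ¬ T b → T (not b)
not-intro {true}  ¬b = ¬b tt
not-intro {false} _  = tt

not-elim : {b : Bool} → T (not b) → ¬ T b
not-elim {true} ()

module _ {A : Set} where

  sumℤ-cong : (xs : List A) {g h : A → ℤ} → (∀ x → g x ≡ h x) → sumℤ xs g ≡ sumℤ xs h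
  sumℤ-cong []       _  = refl
  sumℤ-cong (x ∷ xs) eq = cong₂ ℤ._+_ (eq x) (sumℤ-cong xs eq)

  sumℤ-zero : (xs : List A) {g : A → ℤ} → (∀ x → g x ≡ + 0) → sumℤ xs g ≡ + 0
  sumℤ-zero []       _  = refl
  sumℤ-zero (x ∷ xs) eq = cong₂ ℤ._+_ (eq x) (sumℤ-zero xs eq)

  sumℤ-neg : (xs : List A) (g : A → ℤ) → sumℤ xs (-_ ∘ g) ≡ - sumℤ xs g
  sumℤ-neg []       g = refl
  sumℤ-neg (x ∷ xs) g rewrite sumℤ-neg xs g = sym (ℤP.neg-distrib-+ (g x) (sumℤ xs g))

  sumℤ-+ : (xs : List A) (g h : A → ℤ) →
    sumℤ xs (λ x → g x ℤ.+ h x) ≡ sumℤ xs g ℤ.+ sumℤ xs h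
  sumℤ-+ []       g h = refl
  sumℤ-+ (x ∷ xs) g h rewrite sumℤ-+ xs g h = interchange (g x) (h x) (sumℤ xs g) (sumℤ xs h)

  sumℤ-++ : (xs ys : List A) (g : A → ℤ) → sumℤ (xs ++ ys) g ≡ sumℤ xs g ℤ.+ sumℤ ys g
  sumℤ-++ []       ys g = sym (ℤP.+-identityˡ _)
  sumℤ-++ (x ∷ xs) ys g rewrite sumℤ-++ xs ys g = sym (ℤP.+-assoc (g x) _ _)

  sumℤ-filterᵇ : (p : A → Bool) (xs : List A) (g : A → ℤ) →
    sumℤ (filterᵇ p xs) g ≡ sumℤ xs (λ x → if p x then g x else + 0)
  sumℤ-filterᵇ p []       g = refl
  sumℤ-filterᵇ p (x ∷ xs) g with p x
  ... | true  = cong (λ s → g x ℤ.+ s) (sumℤ-filterᵇ p xs g)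
  ... | false = trans (sumℤ-filterᵇ p xs g) (sym (ℤP.+-identityˡ _))

sumℤ-map : {A B : Set} (h : A → B) (xs : List A) (g : B → ℤ) →
  sumℤ (map h xs) g ≡ sumℤ xs (g ∘ h)
sumℤ-map h []       g = refl
sumℤ-map h (x ∷ xs) g = cong (λ s → g (h x) ℤ.+ s) (sumℤ-map h xs g)

sumℤ-tabulate : {A : Set} {n : ℕ} (h : Fin n → A) (g : A → ℤ) →
  sumℤ (List.tabulate h) g ≡ sumℤ (allFinL n) (g ∘ h)
sumℤ-tabulate {n = zero}  h g = refl
sumℤ-tabulate {n = suc n} h g = cong (λ s → g (h zero) ℤ.+ s)
  (trans (sumℤ-tabulate (h ∘ suc) g) (sym (sumℤ-tabulate suc (g ∘ h))))

_≟ₛ_ : {n : ℕ} (p q : Subset n) → Dec (p ≡ q)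
_≟ₛ_ = VecP.≡-dec _≟ᵇ_

∈-allSubsets : {n : ℕ} (p : Subset n) → p ∈ allSubsets n
∈-allSubsets []                = here refl
∈-allSubsets {suc n} (false ∷ p) = ∈-++⁺ˡ (∈-map⁺ (false ∷_) (∈-allSubsets p))
∈-allSubsets {suc n} (true ∷ p)  =
  ∈-++⁺ʳ (map (false ∷_) (allSubsets n)) (∈-map⁺ (true ∷_) (∈-allSubsets p))

sumℤ-allSubsets-suc : {n : ℕ} (g : Subset (suc n) → ℤ) →
  sumℤ (allSubsets (suc n)) g ≡
  sumℤ (allSubsets n) (g ∘ (false ∷_)) ℤ.+ sumℤ (allSubsets n) (g ∘ (true ∷_))
sumℤ-allSubsets-suc {n} g
  rewrite sumℤ-++ (map (false ∷_) (allSubsets n)) (map (true ∷_) (allSubsets n)) g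
        | sumℤ-map (false ∷_) (allSubsets n) g
        | sumℤ-map (true ∷_) (allSubsets n) g = refl

sumℤ-allSubsets-point : {n : ℕ} (p : Subset n) (g : Subset n → ℤ) →
  (∀ q → q ≢ p → g q ≡ + 0) → sumℤ (allSubsets n) g ≡ g p
sumℤ-allSubsets-point [] g _ = ℤP.+-identityʳ _
sumℤ-allSubsets-point {suc n} (false ∷ p) g vanish
  rewrite sumℤ-allSubsets-suc g
        | sumℤ-allSubsets-point p (g ∘ (false ∷_)) (λ q q≢p → vanish _ (q≢p ∘ VecP.∷-injectiveʳ))
        | sumℤ-zero (allSubsets n) {g ∘ (true ∷_)} (λ q → vanish _ λ ())
        = ℤP.+-identityʳ _
sumℤ-allSubsets-point {suc n} (true ∷ p) g vanish
  rewrite sumℤ-allSubsets-suc g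
        | sumℤ-allSubsets-point p (g ∘ (true ∷_)) (λ q q≢p → vanish _ (q≢p ∘ VecP.∷-injectiveʳ))
        | sumℤ-zero (allSubsets n) {g ∘ (false ∷_)} (λ q → vanish _ λ ())
        = ℤP.+-identityˡ _

sumℤ-allSubsets-split : {n : ℕ} (p : Subset n) (g : Subset n → ℤ) →
  sumℤ (allSubsets n) g ≡
  g p ℤ.+ sumℤ (allSubsets n) (λ q → if does (q ≟ₛ p) then + 0 else g q)
sumℤ-allSubsets-split {n} p g = begin
  sumℤ (allSubsets n) g                    ≡⟨ sumℤ-cong (allSubsets n) split ⟩
  sumℤ (allSubsets n) (λ q → at q ℤ.+ off q) ≡⟨ sumℤ-+ (allSubsets n) at off ⟩
  sumℤ (allSubsets n) at ℤ.+ sumℤ (allSubsets n) off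
    ≡⟨ cong (ℤ._+ sumℤ (allSubsets n) off) (sumℤ-allSubsets-point p at at-vanish) ⟩
  at p ℤ.+ sumℤ (allSubsets n) off         ≡⟨ cong (ℤ._+ sumℤ (allSubsets n) off) at-p ⟩
  g p ℤ.+ sumℤ (allSubsets n) off          ∎
  where
  open ≡-Reasoning
  at off : Subset n → ℤ
  at  q = if does (q ≟ₛ p) then g q else + 0
  off q = if does (q ≟ₛ p) then + 0 else g q
  split : ∀ q → g q ≡ at q ℤ.+ off q
  split q with q ≟ₛ p
  ... | yes _ = sym (ℤP.+-identityʳ _)
  ... | no  _ = sym (ℤP.+-identityˡ _)
  at-vanish : ∀ q → q ≢ p → at q ≡ + 0
  at-vanish q q≢p with q ≟ₛ p
  ... | yes q≡p = ⊥-elim (q≢p q≡p)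
  ... | no  _   = refl
  at-p : at p ≡ g p
  at-p with p ≟ₛ p
  ... | yes _   = refl
  ... | no  p≢p = ⊥-elim (p≢p refl)

module _ {A : Set} {p q : A → Bool} (p⇒q : ∀ x → T (p x) → T (q x)) where

  length-filterᵇ-mono : (xs : List A) → length (filterᵇ p xs) ≤ length (filterᵇ q xs)
  length-filterᵇ-mono [] = z≤n
  length-filterᵇ-mono (x ∷ xs) with p x in px | q x in qx
  ... | true  | true  = s≤s (length-filterᵇ-mono xs)
  ... | false | true  = ℕP.m≤n⇒m≤1+n (length-filterᵇ-mono xs)
  ... | false | false = length-filterᵇ-mono xs
  ... | true  | false = ⊥-elim (subst T qx (p⇒q x (subst T (sym px) tt)))

  length-filterᵇ-strict : {y : A} {xs : List A} → y ∈ xs → T (q y) → ¬ T (p y) →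
    length (filterᵇ p xs) < length (filterᵇ q xs)
  length-filterᵇ-strict {xs = x ∷ xs} (here refl) qy ¬py with p x | q x
  ... | true  | _     = ⊥-elim (¬py tt)
  ... | false | false = ⊥-elim qy
  ... | false | true  = s≤s (length-filterᵇ-mono xs)
  length-filterᵇ-strict {xs = x ∷ xs} (there y∈xs) qy ¬py
    with length-filterᵇ-strict y∈xs qy ¬py | p x in px | q x in qx
  ... | lt | true  | true  = s≤s lt
  ... | lt | false | true  = ℕP.m≤n⇒m≤1+n lt
  ... | lt | false | false = lt
  ... | _  | true  | false = ⊥-elim (subst T qx (p⇒q x (subst T (sym px) tt)))

length-filterᵇ-∧-complete : {A : Set} (p q : A → Bool) {xs : List A} →
  length (filterᵇ (λ x → p x ∧ q x) xs) ≡ length (filterᵇ p xs) →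
  {y : A} → y ∈ xs → T (p y) → T (q y)
length-filterᵇ-∧-complete p q same {y} y∈xs py with q y in qy
... | true  = tt
... | false = ⊥-elim (ℕP.<-irrefl same
  (length-filterᵇ-strict (λ x → proj₁ ∘ ∧-elim {p x}) y∈xs py
    (λ pqy → subst T qy (proj₂ (∧-elim {p y} pqy)))))

incidenceTerm : {n : ℕ} → Subset n → Subset n → Fin n → ℤ
incidenceTerm r f v =
  if not (memᵇ v r) ∧ (f == (r ∪ᵇ single v)) then negOnePow ∣ r ∩ below v ∣ else + 0

incidence-∷ : {n : ℕ} (x y : Bool) (τ σ : Subset n) →
  incidence (x ∷ τ) (y ∷ σ) ≡
  incidenceTerm (x ∷ τ) (y ∷ σ) zero ℤ.+ sumℤ (allFinL n) (incidenceTerm (x ∷ τ) (y ∷ σ) ∘ suc)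
incidence-∷ {n} x y τ σ =
  cong (λ s → incidenceTerm (x ∷ τ) (y ∷ σ) zero ℤ.+ s) (sumℤ-tabulate {n = n} Fin.suc (incidenceTerm (x ∷ τ) (y ∷ σ)))

negOnePow-suc : (k : ℕ) → negOnePow (suc k) ≡ - negOnePow k
negOnePow-suc zero          = refl
negOnePow-suc (suc zero)    = refl
negOnePow-suc (suc (suc k)) = negOnePow-suc k

-- Not Data.Fin.Subset.⊥: this is what the tails of single zero and below zero reduce to.
∅ : {n : ℕ} → Subset n
∅ = tabulate (λ _ → false)

∅-⊆ᵇ : {n : ℕ} (τ : Subset n) → ∅ ⊆ᵇ τ ≡ true
∅-⊆ᵇ []      = refl
∅-⊆ᵇ (_ ∷ τ) = ∅-⊆ᵇ τ

∪ᵇ-∅ : {n : ℕ} (τ : Subset n) → τ ∪ᵇ ∅ ≡ τ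
∪ᵇ-∅ []      = refl
∪ᵇ-∅ (x ∷ τ) = cong₂ _∷_ (∨-identityʳ x) (∪ᵇ-∅ τ)

∣∩∅∣ : {n : ℕ} (τ : Subset n) → ∣ τ ∩ ∅ ∣ ≡ 0
∣∩∅∣ []          = refl
∣∩∅∣ (false ∷ τ) = ∣∩∅∣ τ
∣∩∅∣ (true ∷ τ)  = ∣∩∅∣ τ

incidence-false-false : {n : ℕ} (τ σ : Subset n) →
  incidence (false ∷ τ) (false ∷ σ) ≡ incidence τ σ
incidence-false-false τ σ rewrite incidence-∷ false false τ σ
  | ∧-zeroʳ (σ ⊆ᵇ (τ ∪ᵇ ∅)) = ℤP.+-identityˡ _

incidence-true-true : {n : ℕ} (τ σ : Subset n) →
  incidence (true ∷ τ) (true ∷ σ) ≡ - incidence τ σ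
incidence-true-true {n} τ σ rewrite incidence-∷ true true τ σ | ∅-⊆ᵇ τ =
  trans (ℤP.+-identityˡ _) (trans (sumℤ-cong (allFinL n) term-suc) (sumℤ-neg (allFinL n) (incidenceTerm τ σ)))
  where
  term-suc : ∀ v → incidenceTerm (true ∷ τ) (true ∷ σ) (suc v) ≡ - incidenceTerm τ σ v
  term-suc v with not (memᵇ v τ) ∧ (σ == (τ ∪ᵇ single v))
  ... | true  = negOnePow-suc ∣ τ ∩ below v ∣
  ... | false = refl

incidence-true-false : {n : ℕ} (τ σ : Subset n) → incidence (true ∷ τ) (false ∷ σ) ≡ + 0
incidence-true-false {n} τ σ rewrite incidence-∷ true false τ σ | ∅-⊆ᵇ τ =
  trans (ℤP.+-identityˡ _) (sumℤ-zero (allFinL n) term-suc)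
  where
  term-suc : ∀ v → incidenceTerm (true ∷ τ) (false ∷ σ) (suc v) ≡ + 0
  term-suc v rewrite ∧-zeroʳ (σ ⊆ᵇ (τ ∪ᵇ single v)) | ∧-zeroʳ (not (memᵇ v τ)) = refl

incidence-false-true : {n : ℕ} (τ σ : Subset n) →
  incidence (false ∷ τ) (true ∷ σ) ≡ (if σ == τ then + 1 else + 0)
incidence-false-true {n} τ σ rewrite incidence-∷ false true τ σ | ∪ᵇ-∅ τ | ∣∩∅∣ τ =
  trans (cong (λ s → (if σ == τ then + 1 else + 0) ℤ.+ s) (sumℤ-zero (allFinL n) term-suc))
        (ℤP.+-identityʳ _)
  where
  term-suc : ∀ v → incidenceTerm (false ∷ τ) (true ∷ σ) (suc v) ≡ + 0
  term-suc v rewrite ∧-zeroʳ (not (memᵇ v τ)) = refl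

⊆ᵇ⇒∣∣≤ : {n : ℕ} (τ σ : Subset n) → T (τ ⊆ᵇ σ) → ∣ τ ∣ ≤ ∣ σ ∣
⊆ᵇ⇒∣∣≤ []          []          _   = z≤n
⊆ᵇ⇒∣∣≤ (false ∷ τ) (false ∷ σ) τ⊆σ = ⊆ᵇ⇒∣∣≤ τ σ τ⊆σ
⊆ᵇ⇒∣∣≤ (false ∷ τ) (true ∷ σ)  τ⊆σ = ℕP.m≤n⇒m≤1+n (⊆ᵇ⇒∣∣≤ τ σ τ⊆σ)
⊆ᵇ⇒∣∣≤ (true ∷ τ)  (true ∷ σ)  τ⊆σ = s≤s (⊆ᵇ⇒∣∣≤ τ σ τ⊆σ)

⊆ᵇ-∣∣≡⇒⊇ᵇ : {n : ℕ} (τ σ : Subset n) → T (τ ⊆ᵇ σ) → ∣ τ ∣ ≡ ∣ σ ∣ → T (σ ⊆ᵇ τ)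
⊆ᵇ-∣∣≡⇒⊇ᵇ []          []          _   _  = tt
⊆ᵇ-∣∣≡⇒⊇ᵇ (false ∷ τ) (false ∷ σ) τ⊆σ eq = ⊆ᵇ-∣∣≡⇒⊇ᵇ τ σ τ⊆σ eq
⊆ᵇ-∣∣≡⇒⊇ᵇ (false ∷ τ) (true ∷ σ)  τ⊆σ eq = ⊥-elim (ℕP.<-irrefl eq (s≤s (⊆ᵇ⇒∣∣≤ τ σ τ⊆σ)))
⊆ᵇ-∣∣≡⇒⊇ᵇ (true ∷ τ)  (true ∷ σ)  τ⊆σ eq = ⊆ᵇ-∣∣≡⇒⊇ᵇ τ σ τ⊆σ (ℕP.suc-injective eq)

neg-square : (i : ℤ) → (- i) ℤ.* (- i) ≡ i ℤ.* i
neg-square i = begin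
  (- i) ℤ.* (- i) ≡⟨ ℤP.neg-distribˡ-* i (- i) ⟨
  - (i ℤ.* (- i)) ≡⟨ cong -_ (ℤP.neg-distribʳ-* i i) ⟨
  - - (i ℤ.* i)   ≡⟨ ℤP.neg-involutive (i ℤ.* i) ⟩
  i ℤ.* i         ∎
  where open ≡-Reasoning

incidence-face-unit : {n : ℕ} (τ σ : Subset n) → T (τ ⊆ᵇ σ) → ∣ σ ∣ ≡ suc ∣ τ ∣ →
  incidence τ σ ℤ.* incidence τ σ ≡ + 1
incidence-face-unit (false ∷ τ) (false ∷ σ) τ⊆σ eq
  rewrite incidence-false-false τ σ = incidence-face-unit τ σ τ⊆σ eq
incidence-face-unit (true ∷ τ) (true ∷ σ) τ⊆σ eq
  rewrite incidence-true-true τ σ | neg-square (incidence τ σ) =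
  incidence-face-unit τ σ τ⊆σ (ℕP.suc-injective eq)
incidence-face-unit (false ∷ τ) (true ∷ σ) τ⊆σ eq rewrite incidence-false-true τ σ
  with σ == τ in σ≟τ
... | true  = refl
... | false = ⊥-elim (subst T σ≟τ
  (∧-intro (⊆ᵇ-∣∣≡⇒⊇ᵇ τ σ τ⊆σ (sym (ℕP.suc-injective eq))) τ⊆σ))

incidence≢0⇒face : {n : ℕ} (τ σ : Subset n) → incidence τ σ ≢ + 0 →
  T (τ ⊆ᵇ σ) × ∣ σ ∣ ≡ suc ∣ τ ∣
incidence≢0⇒face [] [] ≢0 = ⊥-elim (≢0 refl)
incidence≢0⇒face (false ∷ τ) (false ∷ σ) ≢0
  rewrite incidence-false-false τ σ = incidence≢0⇒face τ σ ≢0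
incidence≢0⇒face (true ∷ τ) (true ∷ σ) ≢0 rewrite incidence-true-true τ σ
  with incidence≢0⇒face τ σ (≢0 ∘ cong -_)
... | τ⊆σ , eq = τ⊆σ , cong suc eq
incidence≢0⇒face (true ∷ τ) (false ∷ σ) ≢0
  rewrite incidence-true-false τ σ = ⊥-elim (≢0 refl)
incidence≢0⇒face (false ∷ τ) (true ∷ σ) ≢0 rewrite incidence-false-true τ σ
  with σ == τ in σ≟τ
... | false = ⊥-elim (≢0 refl)
... | true  = τ⊆σ , cong suc (ℕP.≤-antisym (⊆ᵇ⇒∣∣≤ σ τ σ⊆τ) (⊆ᵇ⇒∣∣≤ τ σ τ⊆σ))
  where
  σ⊆τ = proj₁ (∧-elim {σ ⊆ᵇ τ} (subst T (sym σ≟τ) tt))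
  τ⊆σ = proj₂ (∧-elim {σ ⊆ᵇ τ} (subst T (sym σ≟τ) tt))

module TriangularSystem {n : ℕ}
  (Column : Subset n → Bool) (a : Subset n → Subset n → ℤ)
  (Pivot : Subset n → Subset n → Bool) (height : Subset n → ℚ)
  (pivot-unique : ∀ {ρ ρ′ σ} → T (Pivot ρ σ) → T (Pivot ρ′ σ) → ρ ≡ ρ′)
  (pivot-unit : ∀ {ρ σ} → T (Pivot ρ σ) → a ρ σ ℤ.* a ρ σ ≡ + 1)
  (pivot-lowest : ∀ {ρ σ σ′} → T (Pivot ρ σ) → T (Column σ′) → σ′ ≢ σ → a ρ σ′ ≢ + 0 →
    height σ ℚ.< height σ′)
  (z : Subset n → ℤ)
  where

  private
    all : List (Subset n)
    all = allSubsets n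

  rowSum : (Subset n → ℤ) → Subset n → ℤ
  rowSum b ρ = sumℤ (filterᵇ Column all) (λ σ → a ρ σ ℤ.* b σ)

  offPivotSum : (Subset n → ℤ) → Subset n → Subset n → ℤ
  offPivotSum b ρ σ = sumℤ all (λ σ′ →
    if does (σ′ ≟ₛ σ) then + 0 else (if Column σ′ then a ρ σ′ ℤ.* b σ′ else + 0))

  step : (Subset n → ℤ) → Subset n → ℤ
  step b σ = sumℤ all (λ ρ →
    if Pivot ρ σ then a ρ σ ℤ.* (z ρ ℤ.- offPivotSum b ρ σ) else + 0)

  rank : Subset n → ℕ
  rank σ = length (filterᵇ (λ τ → Column τ ∧ ⌊ height σ ℚP.<? height τ ⌋) all)

  rank-< : ∀ {σ σ′} → T (Column σ′) → height σ ℚ.< height σ′ → rank σ′ < rank σ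
  rank-< {σ} {σ′} col σ<σ′ =
    length-filterᵇ-strict higher (∈-allSubsets σ′) (∧-intro col (fromWitness σ<σ′))
      (λ σ′<σ′ → ℚP.<-irrefl refl (toWitness (proj₂ (∧-elim {Column σ′} σ′<σ′))))
    where
    higher : ∀ τ → T (Column τ ∧ ⌊ height σ′ ℚP.<? height τ ⌋) →
             T (Column τ ∧ ⌊ height σ ℚP.<? height τ ⌋)
    higher τ h with ∧-elim {Column τ} h
    ... | colτ , σ′<τ = ∧-intro colτ (fromWitness (ℚP.<-trans σ<σ′ (toWitness σ′<τ)))

  step-local : ∀ {b b′ σ} → (∀ σ′ → rank σ′ < rank σ → b σ′ ≡ b′ σ′) → step b σ ≡ step b′ σ
  step-local {b} {b′} {σ} agree = sumℤ-cong all at-row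
    where
    at-column : ∀ ρ → T (Pivot ρ σ) → ∀ σ′ →
      (if does (σ′ ≟ₛ σ) then + 0 else (if Column σ′ then a ρ σ′ ℤ.* b σ′ else + 0)) ≡
      (if does (σ′ ≟ₛ σ) then + 0 else (if Column σ′ then a ρ σ′ ℤ.* b′ σ′ else + 0))
    at-column ρ piv σ′ with σ′ ≟ₛ σ | Column σ′ in col
    ... | yes _   | _     = refl
    ... | no  _   | false = refl
    ... | no  σ′≢σ | true with a ρ σ′ ℤP.≟ + 0
    ...   | yes a≡0 rewrite a≡0 = refl
    ...   | no  a≢0 = cong (a ρ σ′ ℤ.*_)
      (agree σ′ (rank-< (subst T (sym col) tt) (pivot-lowest piv (subst T (sym col) tt) σ′≢σ a≢0)))
    at-row : ∀ ρ →
      (if Pivot ρ σ then a ρ σ ℤ.* (z ρ ℤ.- offPivotSum b ρ σ) else + 0) ≡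
      (if Pivot ρ σ then a ρ σ ℤ.* (z ρ ℤ.- offPivotSum b′ ρ σ) else + 0)
    at-row ρ with Pivot ρ σ in piv
    ... | false = refl
    ... | true  = cong (λ s → a ρ σ ℤ.* (z ρ ℤ.- s))
      (sumℤ-cong all (at-column ρ (subst T (sym piv) tt)))

  -- step solves each pivot row for its pivot column. The new value at σ only reads columns
  -- of smaller rank, so after more than rank σ iterations it no longer changes.
  iterate : ℕ → Subset n → ℤ
  iterate zero    _ = + 0
  iterate (suc k)   = step (iterate k)

  iterate-stable : ∀ k σ → rank σ < k → iterate k σ ≡ iterate (suc k) σ
  iterate-stable (suc k) σ (s≤s rank≤k) =
    step-local (λ σ′ lower → iterate-stable k σ′ (ℕP.<-≤-trans lower rank≤k))

  solution : Subset n → ℤ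
  solution = iterate (suc (length all))

  solution-fixed : ∀ σ → solution σ ≡ step solution σ
  solution-fixed σ = iterate-stable _ σ (s≤s (length-filter (T? ∘ _) all))

  step-at-pivot : ∀ {ρ σ} b → T (Pivot ρ σ) → step b σ ≡ a ρ σ ℤ.* (z ρ ℤ.- offPivotSum b ρ σ)
  step-at-pivot {ρ} {σ} b piv = trans (sumℤ-allSubsets-point ρ _ other-rows) (if-T piv)
    where
    other-rows : ∀ ρ′ → ρ′ ≢ ρ →
      (if Pivot ρ′ σ then a ρ′ σ ℤ.* (z ρ′ ℤ.- offPivotSum b ρ′ σ) else + 0) ≡ + 0
    other-rows ρ′ ρ′≢ρ with Pivot ρ′ σ in piv′
    ... | false = refl
    ... | true  = ⊥-elim (ρ′≢ρ (pivot-unique (subst T (sym piv′) tt) piv))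

  rowSum-split : ∀ {σ} b ρ → T (Column σ) → rowSum b ρ ≡ a ρ σ ℤ.* b σ ℤ.+ offPivotSum b ρ σ
  rowSum-split {σ} b ρ col = begin
    rowSum b ρ
      ≡⟨ sumℤ-filterᵇ Column all (λ σ′ → a ρ σ′ ℤ.* b σ′) ⟩
    sumℤ all (λ σ′ → if Column σ′ then a ρ σ′ ℤ.* b σ′ else + 0)
      ≡⟨ sumℤ-allSubsets-split σ (λ σ′ → if Column σ′ then a ρ σ′ ℤ.* b σ′ else + 0) ⟩
    (if Column σ then a ρ σ ℤ.* b σ else + 0) ℤ.+ offPivotSum b ρ σ
      ≡⟨ cong (ℤ._+ offPivotSum b ρ σ) (if-T col) ⟩
    a ρ σ ℤ.* b σ ℤ.+ offPivotSum b ρ σ ∎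
    where open ≡-Reasoning

  solution-solves : ∀ {ρ σ} → T (Pivot ρ σ) → T (Column σ) → rowSum solution ρ ≡ z ρ
  solution-solves {ρ} {σ} piv col = begin
    rowSum solution ρ                        ≡⟨ rowSum-split solution ρ col ⟩
    e ℤ.* solution σ ℤ.+ off                 ≡⟨ cong (λ s → e ℤ.* s ℤ.+ off) (solution-fixed σ) ⟩
    e ℤ.* step solution σ ℤ.+ off            ≡⟨ cong (λ s → e ℤ.* s ℤ.+ off) (step-at-pivot solution piv) ⟩
    e ℤ.* (e ℤ.* (z ρ ℤ.- off)) ℤ.+ off      ≡⟨ cong (ℤ._+ off) (ℤP.*-assoc e e _) ⟨
    e ℤ.* e ℤ.* (z ρ ℤ.- off) ℤ.+ off        ≡⟨ cong (λ u → u ℤ.* (z ρ ℤ.- off) ℤ.+ off) (pivot-unit piv) ⟩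
    + 1 ℤ.* (z ρ ℤ.- off) ℤ.+ off            ≡⟨ cong (ℤ._+ off) (ℤP.*-identityˡ (z ρ ℤ.- off)) ⟩
    z ρ ℤ.- off ℤ.+ off                      ≡⟨ //-rightDividesˡ off (z ρ) ⟩
    z ρ                                      ∎
    where
    open ≡-Reasoning
    e   = a ρ σ
    off = offPivotSum solution ρ σ

module _ {n : ℕ} (K : Family n) where

  cellOfSize-intro : ∀ {s σ} → T (isCell K σ) → ∣ σ ∣ ≡ s → T (cellOfSize K s σ)
  cellOfSize-intro {s} {σ} cσ eq = ∧-intro cσ (ℕP.≡⇒≡ᵇ ∣ σ ∣ s eq)

  cellOfSize-elim : ∀ {s σ} → T (cellOfSize K s σ) → T (isCell K σ) × ∣ σ ∣ ≡ s
  cellOfSize-elim {s} {σ} cell with ∧-elim {isCell K σ} cell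
  ... | cσ , size = cσ , ℕP.≡ᵇ⇒≡ ∣ σ ∣ s size

  face-intro : ∀ {τ σ} → T (isCell K τ) → T (isCell K σ) → T (τ ⊆ᵇ σ) → ∣ σ ∣ ≡ suc ∣ τ ∣ →
    T (faceᵇ K τ σ)
  face-intro cτ cσ τ⊆σ eq = ∧-intro cτ (∧-intro cσ (∧-intro τ⊆σ (ℕP.≡⇒≡ᵇ _ _ eq)))

  face-elim : ∀ {τ σ} → T (faceᵇ K τ σ) →
    T (isCell K τ) × T (isCell K σ) × T (τ ⊆ᵇ σ) × ∣ σ ∣ ≡ suc ∣ τ ∣
  face-elim {τ} {σ} face with ∧-elim {isCell K τ} face
  ... | cτ , rest with ∧-elim {isCell K σ} rest
  ... | cσ , rest′ with ∧-elim {τ ⊆ᵇ σ} rest′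
  ... | τ⊆σ , size = cτ , cσ , τ⊆σ , ℕP.≡ᵇ⇒≡ ∣ σ ∣ (suc ∣ τ ∣) size

  critical-of-count : ∀ {f s σ} → numCritical K f s ≡ numCells K s →
    T (cellOfSize K s σ) → T (critical K f σ)
  critical-of-count {f} {s} {σ} same =
    length-filterᵇ-∧-complete (cellOfSize K s) (critical K f) same (∈-allSubsets σ)

module Gradient {n : ℕ} (K : Family n) (f : Subset n → ℚ) (morse : IsDiscreteMorse K f) where

  gradientᵇ : Subset n → Subset n → Bool
  gradientᵇ τ σ = faceᵇ K τ σ ∧ (f σ ℚ.≤ᵇ f τ)

  gradient-elim : ∀ {τ σ} → T (gradientᵇ τ σ) → T (faceᵇ K τ σ) × f σ ℚ.≤ f τ
  gradient-elim {τ} {σ} grad with ∧-elim {faceᵇ K τ σ} grad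
  ... | face , le = face , ℚP.≤ᵇ⇒≤ le

  critical⇒no-gradient-below : ∀ {τ σ} → T (critical K f σ) → ¬ T (gradientᵇ τ σ)
  critical⇒no-gradient-below {τ} {σ} crit grad =
    not-elim (proj₁ (∧-elim crit)) (any⁺ (λ ρ → gradientᵇ ρ σ) (lose (∈-allSubsets τ) grad))

  critical⇒no-gradient-above : ∀ {τ σ} → T (critical K f τ) → ¬ T (gradientᵇ τ σ)
  critical⇒no-gradient-above {τ} {σ} crit grad =
    not-elim (proj₂ (∧-elim {not (any (λ ρ → gradientᵇ ρ τ) (allSubsets n))} crit))
      (any⁺ (gradientᵇ τ) (lose (∈-allSubsets σ) grad))

  ¬critical⇒gradient : ∀ {σ} → ¬ T (critical K f σ) →
    (∃ λ τ → T (gradientᵇ τ σ)) ⊎ (∃ λ τ → T (gradientᵇ σ τ))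
  ¬critical⇒gradient {σ} ¬crit
    with any (λ τ → gradientᵇ τ σ) (allSubsets n) in below
       | any (gradientᵇ σ) (allSubsets n) in above
  ... | true  | _     = inj₁ (satisfied (any⁻ _ (allSubsets n) (subst T (sym below) tt)))
  ... | false | true  = inj₂ (satisfied (any⁻ _ (allSubsets n) (subst T (sym above) tt)))
  ... | false | false = ⊥-elim (¬crit tt)

  gradient-unique : ∀ {ρ ρ′ σ} → T (gradientᵇ ρ σ) → T (gradientᵇ ρ′ σ) → ρ ≡ ρ′
  gradient-unique {ρ} {ρ′} {σ} grad grad′ =
    proj₁ (morse σ (proj₁ (proj₂ (face-elim K face)))) ρ ρ′ face face′
      (ℚP.≤⇒≤ᵇ le) (ℚP.≤⇒≤ᵇ le′)
    where
    face = proj₁ (gradient-elim grad)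
    le   = proj₂ (gradient-elim grad)
    face′ = proj₁ (gradient-elim grad′)
    le′   = proj₂ (gradient-elim grad′)

  gradient-other-coface-higher : ∀ {ρ σ σ′} → T (gradientᵇ ρ σ) → T (faceᵇ K ρ σ′) →
    σ′ ≢ σ → f σ ℚ.< f σ′
  gradient-other-coface-higher {ρ} {σ} {σ′} grad face′ σ′≢σ =
    ℚP.≤-<-trans le (ℚP.≰⇒> σ′≰ρ)
    where
    face = proj₁ (gradient-elim grad)
    le   = proj₂ (gradient-elim grad)
    σ′≰ρ : ¬ f σ′ ℚ.≤ f ρ
    σ′≰ρ le′ = σ′≢σ (sym (proj₂ (morse ρ (proj₁ (face-elim K face))) σ σ′ face face′
      (ℚP.≤⇒≤ᵇ le) (ℚP.≤⇒≤ᵇ le′)))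

  gradient-partner : ∀ {τ} → ¬ T (critical K f τ) →
    (∀ ρ → T (faceᵇ K ρ τ) → T (critical K f ρ)) → ∃ λ σ → T (gradientᵇ τ σ)
  gradient-partner ¬crit faces-critical with ¬critical⇒gradient ¬crit
  ... | inj₂ partner       = partner
  ... | inj₁ (ρ , grad) =
    ⊥-elim (critical⇒no-gradient-above (faces-critical ρ (proj₁ (gradient-elim grad))) grad)

module RelativeBoundary {n : ℕ} (K : Family n) (d : ℕ) (F R : Family n)
  (f : Subset n → ℚ) (morse : IsDiscreteMorse K f)
  (counts : (s : ℕ) → s < d → numCritical K f s ≡ numCells K s)
  (F≡ : (σ : Subset n) → F σ ≡ (cellOfSize K (suc d) σ ∧ not (critical K f σ)))
  (R≡ : (σ : Subset n) → R σ ≡ (cellOfSize K d σ ∧ critical K f σ))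
  where

  open Gradient K f morse

  X A : Family n
  X = pairTop K d F
  A = pairBot K d R

  F-intro : ∀ {σ} → T (isCell K σ) → ∣ σ ∣ ≡ suc d → ¬ T (critical K f σ) → T (F σ)
  F-intro {σ} cσ size ¬crit =
    subst T (sym (F≡ σ)) (∧-intro (cellOfSize-intro K cσ size) (not-intro ¬crit))

  F-elim : ∀ {σ} → T (F σ) → T (isCell K σ) × ∣ σ ∣ ≡ suc d × ¬ T (critical K f σ)
  F-elim {σ} Fσ with ∧-elim {cellOfSize K (suc d) σ} (subst T (F≡ σ) Fσ)
  ... | cell , ¬crit with cellOfSize-elim K cell
  ... | cσ , size = cσ , size , not-elim ¬crit

  R-intro : ∀ {σ} → T (isCell K σ) → ∣ σ ∣ ≡ d → T (critical K f σ) → T (R σ)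
  R-intro {σ} cσ size crit = subst T (sym (R≡ σ)) (∧-intro (cellOfSize-intro K cσ size) crit)

  R-size : ∀ {σ} → T (R σ) → ∣ σ ∣ ≡ d
  R-size {σ} Rσ =
    proj₂ (cellOfSize-elim K (proj₁ (∧-elim {cellOfSize K d σ} (subst T (R≡ σ) Rσ))))

  row-elim : ∀ {τ} → T (relCell X A d τ) → ∣ τ ∣ ≡ d × ¬ T (critical K f τ)
  row-elim {τ} row = size , ¬crit
    where
    parts = ∧-elim {X τ} row
    size : ∣ τ ∣ ≡ d
    size = ℕP.≡ᵇ⇒≡ ∣ τ ∣ d (proj₂ (∧-elim (proj₂ (∧-elim {not (A τ)} (proj₂ parts)))))
    cell : T (isCell K τ)
    cell with Equivalence.to (T-∨ {isCell K τ ∧ (∣ τ ∣ <ᵇ suc d)}) (proj₁ parts)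
    ... | inj₁ small = proj₁ (∧-elim {isCell K τ} small)
    ... | inj₂ Fτ    = ⊥-elim (ℕP.1+n≢n (trans (sym (proj₁ (proj₂ (F-elim Fτ)))) size))
    ¬crit : ¬ T (critical K f τ)
    ¬crit crit = not-elim (proj₁ (∧-elim {not (A τ)} (proj₂ parts)))
      (Equivalence.from (T-∨ {isCell K τ ∧ (∣ τ ∣ <ᵇ d)}) (inj₂ (R-intro cell size crit)))

  F⇒column : ∀ {σ} → T (F σ) → T (relCell X A (suc d) σ)
  F⇒column {σ} Fσ =
    ∧-intro (Equivalence.from (T-∨ {isCell K σ ∧ (∣ σ ∣ <ᵇ suc d)}) (inj₂ Fσ))
      (∧-intro (not-intro ¬A)
        (∧-intro (subst (λ m → T (not (m ≡ᵇ 0))) (sym size) tt) (ℕP.≡⇒≡ᵇ _ _ size)))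
    where
    size = proj₁ (proj₂ (F-elim Fσ))
    ¬A : ¬ T (A σ)
    ¬A Aσ with Equivalence.to (T-∨ {isCell K σ ∧ (∣ σ ∣ <ᵇ d)}) Aσ
    ... | inj₁ small = ℕP.<-asym (ℕP.<ᵇ⇒< ∣ σ ∣ d (proj₂ (∧-elim {isCell K σ} small)))
                         (subst (d <_) (sym size) (ℕP.n<1+n d))
    ... | inj₂ Rσ    = ℕP.1+n≢n (trans (sym size) (R-size Rσ))

  column⇒cell : ∀ {σ} → T (relCell X A (suc d) σ) → T (isCell K σ)
  column⇒cell {σ} col with Equivalence.to (T-∨ {isCell K σ ∧ (∣ σ ∣ <ᵇ suc d)})
                             (proj₁ (∧-elim {X σ} col))
  ... | inj₁ small = proj₁ (∧-elim {isCell K σ} small)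
  ... | inj₂ Fσ    = proj₁ (F-elim Fσ)

  faces-critical : ∀ {τ} → ∣ τ ∣ ≡ d → ∀ ρ → T (faceᵇ K ρ τ) → T (critical K f ρ)
  faces-critical {τ} size ρ face with face-elim K face
  ... | cρ , _ , _ , τ≡1+ρ =
    critical-of-count K {f = f} (counts ∣ ρ ∣ ρ<d) (cellOfSize-intro K cρ refl)
    where
    ρ<d : ∣ ρ ∣ < d
    ρ<d = subst (∣ ρ ∣ <_) (trans (sym τ≡1+ρ) size) (ℕP.n<1+n ∣ ρ ∣)

  row-pivot : ∀ {τ} → T (relCell X A d τ) →
    ∃ λ σ → T (gradientᵇ τ σ) × T (relCell X A (suc d) σ)
  row-pivot {τ} row with row-elim row
  ... | size , ¬crit with gradient-partner ¬crit (faces-critical size)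
  ... | σ , grad with face-elim K (proj₁ (gradient-elim grad))
  ...   | _ , cσ , _ , σ≡1+τ = σ , grad , F⇒column (F-intro cσ (trans σ≡1+τ (cong suc size))
    (λ crit → critical⇒no-gradient-below crit grad))

  gradient-face-unit : ∀ {ρ σ} → T (gradientᵇ ρ σ) → incidence ρ σ ℤ.* incidence ρ σ ≡ + 1
  gradient-face-unit {ρ} {σ} grad with face-elim K (proj₁ (gradient-elim grad))
  ... | _ , _ , ρ⊆σ , size = incidence-face-unit ρ σ ρ⊆σ size

  gradient-lowest-column : ∀ {ρ σ σ′} → T (gradientᵇ ρ σ) → T (relCell X A (suc d) σ′) →
    σ′ ≢ σ → incidence ρ σ′ ≢ + 0 → f σ ℚ.< f σ′
  gradient-lowest-column {ρ} {σ} {σ′} grad col σ′≢σ ≢0 =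
    gradient-other-coface-higher grad
      (face-intro K (proj₁ (face-elim K (proj₁ (gradient-elim grad)))) (column⇒cell col)
        (proj₁ (incidence≢0⇒face ρ σ′ ≢0)) (proj₂ (incidence≢0⇒face ρ σ′ ≢0)))
      σ′≢σ

  boundary-surjective : ∀ z → IsRelBoundary X A d z
  boundary-surjective z = solution , λ τ row →
    let σ , grad , col = row-pivot row in solution-solves grad col
    where
    open TriangularSystem (relCell X A (suc d)) incidence gradientᵇ f
      gradient-unique gradient-face-unit gradient-lowest-column z

corollary4p3 : {n : ℕ} (K : Family n) (d : ℕ) (F R : Family n) →
    IsSimplicialComplex K → IsDimension K d →
    IsRootedForest K d F R → CorrespondsToGradient K d F R →
    HdMinus1Vanishes K d F R
corollary4p3 K d F R _ _ _ (_ , f , (morse , _ , counts) , F≡ , R≡) z _ =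
  RelativeBoundary.boundary-surjective K d F R f morse counts F≡ R≡ z
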